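{- Let $n \ge 1$ and let $d_1, d_2, \dots, d_n$ be positive integers. Then there exists a connected signed bipartite graph $G(U,V)$ whose signed degree set is $$S = \Big\{ d_1,\ \sum_{i=1}^{2} d_i,\ \dots,\ \sum_{i=1}^{n} d_i \Big\}.$$
   Context: A bipartite graph $G(U,V)$ is a finite simple graph whose vertex set is partitioned into two nonempty disjoint sets $U$ and $V$ such that every edge joins a vertex of $U$ to a vertex of $V$. A signed bipartite graph is a bipartite graph in which each edge is assigned a sign, positive or negative. The signed degree of a vertex $x$ is the number of positive edges incident with $x$ minus the number of negative edges incident with $x$. The signed degree set of a signed bipartite graph is the set of distinct signed degrees of its vertices. The signed bipartite graph is connected if its underlying graph is connected (every vertex of $U$ is joined by a path to every vertex of $V$). -}

module Defs where

open import Data.Nat using (ℕ; zero; suc)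
open import Data.Fin using (Fin; toℕ; _≤?_)
open import Data.Product using (∃-syntax; _,_)
open import Relation.Binary.PropositionalEquality using (_≡_)
open import Relation.Binary.Construct.Closure.ReflexiveTransitive using (Star) public
open import Data.Integer using (ℤ; +_; -_; 0ℤ; 1ℤ; -1ℤ; _+_)
open import Data.Sum using (_⊎_; inj₁; inj₂)
open import Data.List using (List; map; filter)
open import Data.Nat.ListAction using (sum)
open import Data.List using (allFin)

data EdgeLabel : Set where
  noEdge posEdge negEdge : EdgeLabel

-- A signed bipartite graph with parts U = Fin p and V = Fin q.
-- Edges only join U to V and there is at most one edge per pair (simple).
record SignedBipartiteGraph (p q : ℕ) : Set where
  field
    label : Fin p → Fin q → EdgeLabel

open SignedBipartiteGraph public

Vertex : ℕ → ℕ → Set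
Vertex p q = Fin p ⊎ Fin q

signValue : EdgeLabel → ℤ
signValue noEdge  = 0ℤ
signValue posEdge = 1ℤ
signValue negEdge = -1ℤ

sumℤ : List ℤ → ℤ
sumℤ = Data.List.foldr _+_ 0ℤ

signedDegree : ∀ {p q} → SignedBipartiteGraph p q → Vertex p q → ℤ
signedDegree G (inj₁ u) = sumℤ (map (λ v → signValue (label G u v)) (allFin _))
signedDegree G (inj₂ v) = sumℤ (map (λ u → signValue (label G u v)) (allFin _))

data IsEdge : EdgeLabel → Set where
  pos : IsEdge posEdge
  neg : IsEdge negEdge

data Adjacent {p q} (G : SignedBipartiteGraph p q) : Vertex p q → Vertex p q → Set where
  uv : ∀ {u v} → IsEdge (label G u v) → Adjacent G (inj₁ u) (inj₂ v)
  vu : ∀ {u v} → IsEdge (label G u v) → Adjacent G (inj₂ v) (inj₁ u)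

Connected : ∀ {p q} → SignedBipartiteGraph p q → Set
Connected G = ∀ x y → Star (Adjacent G) x y

InSignedDegreeSet : ∀ {p q} → SignedBipartiteGraph p q → ℤ → Set
InSignedDegreeSet G z = ∃[ x ] signedDegree G x ≡ z

-- Partial sum d₁ + … + d_{k+1} (k : Fin n is 0-indexed).
partialSum : ∀ {n} → (Fin n → ℕ) → Fin n → ℕ
partialSum {n} d k = sum (map d (filter (λ i → i ≤? k) (allFin n)))

{-# OPTIONS --safe #-}
module Submission where

-- Let D = d₁ + ⋯ + d_n and cut {0, …, D − 1} into consecutive blocks B₀, …, B_{n−1} of sizes
-- d₁, …, d_n.  Take U = V = {0, …, D − 1} and join u ∈ B_i to v ∈ B_j by a positive edge iff
-- i + j < n.  A vertex of B_i is then adjacent exactly to B₀ ∪ ⋯ ∪ B_{n−1−i} on the other side, so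
-- its signed degree is d₁ + ⋯ + d_{n−i}, and i = 0, …, n − 1 yields every partial sum.  The
-- vertices of B₀ are adjacent to the whole other side, which makes the graph connected.

open import Defs
open import Data.Bool using (true; false)
open import Data.Fin using (Fin; zero; suc; toℕ; fromℕ<; opposite; _≤?_)
open import Data.Fin.Properties using (toℕ<n; toℕ-fromℕ<; toℕ-injective; opposite-prop; opposite-involutive)
open import Data.Integer as ℤ using (ℤ; +_; 0ℤ; 1ℤ)
open import Data.List using (List; []; _∷_; map; filter; tabulate; allFin)
open import Data.List.Properties using (map-tabulate; map-∘; filter-none; filter-≐)
open import Data.List.Relation.Unary.All.Properties using (tabulate⁺)
open import Data.Nat using (ℕ; zero; suc; _+_; _∸_; _≤_; _<_; _≥_; z≤n; s≤s; s≤s⁻¹; z<s; s<s; s<s⁻¹; _<?_)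
open import Data.Nat.ListAction using (sum)
open import Data.Nat.Properties
  using (≤-refl; ≤-trans; ≤-<-trans; ≮⇒≥; m≤m+n; m+n≮m; m+n∸m≡n; m∸n≤m; +-∸-assoc; +-comm; +-identityʳ; +-monoʳ-≤)
open import Data.Product using (Σ; ∃-syntax; _×_; _,_)
open import Data.Sum using (inj₁; inj₂; reduce)
open import Function using (_∘_; id)
open import Function.Bundles using (_⇔_; mk⇔; Equivalence)
open import Function.Properties.Equivalence using () renaming (trans to ⇔-trans)
open import Relation.Binary.Construct.Closure.ReflexiveTransitive using (ε; _◅_)
open import Relation.Binary.PropositionalEquality using (_≡_; refl; sym; trans; cong; subst; module ≡-Reasoning)
open import Relation.Nullary using (Dec; yes; no; does; contradiction)
open import Relation.Unary using (Pred; Decidable)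

filter-map : ∀ {a b p} {A : Set a} {B : Set b} {P : Pred B p} (P? : Decidable P) (f : A → B) (xs : List A) →
  filter P? (map f xs) ≡ map f (filter (P? ∘ f) xs)
filter-map P? f [] = refl
filter-map P? f (x ∷ xs) with does (P? (f x))
... | true  = cong (f x ∷_) (filter-map P? f xs)
... | false = filter-map P? f xs

m∸n<o⇔m<n+o : ∀ {m n o} → n ≤ m → m ∸ n < o ⇔ m < n + o
m∸n<o⇔m<n+o z≤n = mk⇔ id id
m∸n<o⇔m<n+o (s≤s n≤m) = mk⇔ (s<s ∘ to) (from ∘ s<s⁻¹) where open Equivalence (m∸n<o⇔m<n+o n≤m)

m+n<o⇔n<o∸m : ∀ m n o → m + n < o ⇔ n < o ∸ m
m+n<o⇔n<o∸m zero    n o       = mk⇔ id id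
m+n<o⇔n<o∸m (suc m) n zero    = mk⇔ (λ ()) (λ ())
m+n<o⇔n<o∸m (suc m) n (suc o) = mk⇔ (to ∘ s<s⁻¹) (s<s ∘ from) where open Equivalence (m+n<o⇔n<o∸m m n o)

prefixSum : ∀ {n} → (Fin n → ℕ) → ℕ → ℕ
prefixSum d zero = 0
prefixSum {zero}  d (suc m) = 0
prefixSum {suc n} d (suc m) = d zero + prefixSum (d ∘ suc) m

prefixSum-mono-≤ : ∀ {n} (d : Fin n → ℕ) {m m′} → m ≤ m′ → prefixSum d m ≤ prefixSum d m′
prefixSum-mono-≤ d {zero} _ = z≤n
prefixSum-mono-≤ {zero} d {suc m} (s≤s _) = z≤n
prefixSum-mono-≤ {suc n} d {suc m} (s≤s m≤m′) = +-monoʳ-≤ (d zero) (prefixSum-mono-≤ (d ∘ suc) m≤m′)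

partialSum≡prefixSum : ∀ {n} (d : Fin n → ℕ) (k : Fin n) → partialSum d k ≡ prefixSum d (suc (toℕ k))
partialSum≡prefixSum {suc n} d zero =
  cong (λ xs → d zero + sum (map d xs)) (filter-none (_≤? zero {n}) (tabulate⁺ {f = suc} λ _ ()))
partialSum≡prefixSum {suc n} d (suc k) = cong (_+_ (d zero)) (begin
  sum (map d (filter (_≤? suc k) (tabulate suc)))
    ≡⟨ cong (sum ∘ map d ∘ filter (_≤? suc k)) (sym (map-tabulate id suc)) ⟩
  sum (map d (filter (_≤? suc k) (map suc (allFin n))))
    ≡⟨ cong (sum ∘ map d) (filter-map (_≤? suc k) suc (allFin n)) ⟩
  sum (map d (map suc (filter (λ i → suc i ≤? suc k) (allFin n))))
    ≡⟨ cong (sum ∘ map d ∘ map suc) (filter-≐ _ (_≤? k) (s≤s⁻¹ , s≤s) (allFin n)) ⟩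
  sum (map d (map suc (filter (_≤? k) (allFin n))))
    ≡⟨ cong sum (sym (map-∘ (filter (_≤? k) (allFin n)))) ⟩
  partialSum (d ∘ suc) k
    ≡⟨ partialSum≡prefixSum (d ∘ suc) k ⟩
  prefixSum (d ∘ suc) (suc (toℕ k)) ∎)
  where open ≡-Reasoning

partialSum-opposite : ∀ {n} (d : Fin n → ℕ) (j : Fin n) → partialSum d (opposite j) ≡ prefixSum d (n ∸ toℕ j)
partialSum-opposite {suc n} d j = begin
  partialSum d (opposite j)                ≡⟨ partialSum≡prefixSum d (opposite j) ⟩
  prefixSum d (suc (toℕ (opposite j)))     ≡⟨ cong (prefixSum d ∘ suc) (opposite-prop j) ⟩
  prefixSum d (suc (n ∸ toℕ j))           ≡⟨ cong (prefixSum d) (sym (+-∸-assoc 1 (s≤s⁻¹ (toℕ<n j)))) ⟩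
  prefixSum d (suc n ∸ toℕ j)             ∎
  where open ≡-Reasoning

block : ∀ {n} → (Fin n → ℕ) → ℕ → ℕ
block {zero}  d y = 0
block {suc n} d y with y <? d zero
... | yes _ = 0
... | no  _ = suc (block (d ∘ suc) (y ∸ d zero))

block<⇔<prefixSum : ∀ {n} (d : Fin n → ℕ) {m} → m ≤ n → ∀ y → block d y < m ⇔ y < prefixSum d m
block<⇔<prefixSum d {zero} _ y = mk⇔ (λ ()) (λ ())
block<⇔<prefixSum {suc n} d {suc m} (s≤s m≤n) y with y <? d zero
... | yes y<d₀ = mk⇔ (λ _ → ≤-trans y<d₀ (m≤m+n _ _)) (λ _ → z<s)
... | no  y≮d₀ = ⇔-trans (mk⇔ s<s⁻¹ s<s)
                  (⇔-trans (block<⇔<prefixSum (d ∘ suc) m≤n (y ∸ d zero)) (m∸n<o⇔m<n+o (≮⇒≥ y≮d₀)))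

block-prefixSum : ∀ {n} (d : Fin n → ℕ) → (∀ i → d i ≥ 1) → ∀ {j} → j < n → block d (prefixSum d j) ≡ j
block-prefixSum {suc n} d d≥1 {zero} _ with 0 <? d zero
... | yes _    = refl
... | no  0≮d₀ = contradiction (d≥1 zero) 0≮d₀
block-prefixSum {suc n} d d≥1 {suc j} (s<s j<n) with d zero + prefixSum (d ∘ suc) j <? d zero
... | yes d₀+s<d₀ = contradiction d₀+s<d₀ (m+n≮m _ _)
... | no  _       = cong suc (begin
  block (d ∘ suc) (d zero + prefixSum (d ∘ suc) j ∸ d zero) ≡⟨ cong (block (d ∘ suc)) (m+n∸m≡n (d zero) _) ⟩
  block (d ∘ suc) (prefixSum (d ∘ suc) j)                   ≡⟨ block-prefixSum (d ∘ suc) (d≥1 ∘ suc) j<n ⟩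
  j                                                          ∎)
  where open ≡-Reasoning

positiveIf : ∀ {p} {P : Set p} → Dec P → EdgeLabel
positiveIf (yes _) = posEdge
positiveIf (no  _) = noEdge

positiveIf-isEdge : ∀ {p} {P : Set p} (P? : Dec P) → P → IsEdge (positiveIf P?)
positiveIf-isEdge (yes _) _ = pos
positiveIf-isEdge (no ¬p) p = contradiction p ¬p

sumℤ-indicator-< : ∀ {m a p} {P : Pred (Fin m) p} (P? : Decidable P) → a ≤ m → (∀ i → P i ⇔ toℕ i < a) →
  sumℤ (tabulate (λ i → signValue (positiveIf (P? i)))) ≡ + a
sumℤ-indicator-< {zero} {zero} _ _ _ = refl
sumℤ-indicator-< {suc m} {zero} P? _ P⇔ with P? zero
... | yes p = contradiction (Equivalence.to (P⇔ zero) p) λ ()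
... | no  _ = cong (ℤ._+_ 0ℤ) (sumℤ-indicator-< (P? ∘ suc) z≤n
                               λ i → mk⇔ (λ p → contradiction (Equivalence.to (P⇔ (suc i)) p) λ ()) λ ())
sumℤ-indicator-< {suc m} {suc a} P? (s≤s a≤m) P⇔ with P? zero
... | yes _ = cong (ℤ._+_ 1ℤ) (sumℤ-indicator-< (P? ∘ suc) a≤m λ i → ⇔-trans (P⇔ (suc i)) (mk⇔ s<s⁻¹ s<s))
... | no ¬p = contradiction (Equivalence.from (P⇔ zero) z<s) ¬p

module BlockGraph {n} (d : Fin n → ℕ) where

  total : ℕ
  total = prefixSum d n

  blockIndex : Fin total → ℕ
  blockIndex y = block d (toℕ y)

  blockGraph : SignedBipartiteGraph total total
  blockGraph = record { label = λ u v → positiveIf (blockIndex u + blockIndex v <? n) }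

  block<n : ∀ y → blockIndex y < n
  block<n y = Equivalence.from (block<⇔<prefixSum d ≤-refl (toℕ y)) (toℕ<n y)

  blockOf : Fin total → Fin n
  blockOf y = fromℕ< (block<n y)

  signedDegree-blockGraph : ∀ x → signedDegree blockGraph x ≡ + partialSum d (opposite (blockOf (reduce x)))
  signedDegree-blockGraph x = begin
    signedDegree blockGraph x                ≡⟨ signedDegree≡prefixSum x ⟩
    + prefixSum d (n ∸ blockIndex y)        ≡⟨ cong (λ b → + prefixSum d (n ∸ b)) (toℕ-fromℕ< (block<n y)) ⟨
    + prefixSum d (n ∸ toℕ (blockOf y))     ≡⟨ cong +_ (partialSum-opposite d (blockOf y)) ⟨
    + partialSum d (opposite (blockOf y))    ∎
    where
    open ≡-Reasoning
    y : Fin total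
    y = reduce x

    neighbourCount : ∀ b {P : Fin total → Set} (P? : Decidable P) →
      (∀ v → P v ⇔ b + blockIndex v < n) →
      sumℤ (map (λ v → signValue (positiveIf (P? v))) (allFin total)) ≡ + prefixSum d (n ∸ b)
    neighbourCount b P? P⇔ = trans (cong sumℤ (map-tabulate id (λ v → signValue (positiveIf (P? v)))))
      (sumℤ-indicator-< P? (prefixSum-mono-≤ d (m∸n≤m n b)) λ v →
        ⇔-trans (P⇔ v) (⇔-trans (m+n<o⇔n<o∸m b _ n) (block<⇔<prefixSum d (m∸n≤m n b) (toℕ v))))

    signedDegree≡prefixSum : ∀ x → signedDegree blockGraph x ≡ + prefixSum d (n ∸ blockIndex (reduce x))
    signedDegree≡prefixSum (inj₁ u) =
      neighbourCount (blockIndex u) (λ v → blockIndex u + blockIndex v <? n) λ _ → mk⇔ id id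
    signedDegree≡prefixSum (inj₂ v) =
      neighbourCount (blockIndex v) (λ u → blockIndex u + blockIndex v <? n) λ u →
        mk⇔ (subst (_< n) (+-comm (blockIndex u) _)) (subst (_< n) (+-comm (blockIndex v) _))

  connected : (hub : Fin total) → blockIndex hub ≡ 0 → Connected blockGraph
  connected hub hub∈block₀ = path
    where
    toHub : ∀ u → IsEdge (label blockGraph u hub)
    toHub u rewrite hub∈block₀ | +-identityʳ (blockIndex u) = positiveIf-isEdge _ (block<n u)

    fromHub : ∀ v → IsEdge (label blockGraph hub v)
    fromHub v rewrite hub∈block₀ = positiveIf-isEdge _ (block<n v)

    path : Connected blockGraph
    path (inj₁ u) (inj₁ u′) = uv (toHub u) ◅ vu (toHub u′) ◅ ε
    path (inj₁ u) (inj₂ v)  = uv (toHub u) ◅ vu (toHub hub) ◅ uv (fromHub v) ◅ ε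
    path (inj₂ v) (inj₁ u)  = vu (fromHub v) ◅ uv (toHub hub) ◅ vu (toHub u) ◅ ε
    path (inj₂ v) (inj₂ v′) = vu (fromHub v) ◅ uv (fromHub v′) ◅ ε

  module _ (d≥1 : ∀ i → d i ≥ 1) where

    firstVertex : Fin n → Fin total
    firstVertex j = fromℕ< (Equivalence.to (block<⇔<prefixSum d ≤-refl (prefixSum d (toℕ j)))
                              (subst (_< n) (sym (block-prefixSum d d≥1 (toℕ<n j))) (toℕ<n j)))

    blockIndex-firstVertex : ∀ j → blockIndex (firstVertex j) ≡ toℕ j
    blockIndex-firstVertex j = trans (cong (block d) (toℕ-fromℕ< _)) (block-prefixSum d d≥1 (toℕ<n j))

    blockOf-firstVertex : ∀ j → blockOf (firstVertex j) ≡ j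
    blockOf-firstVertex j = toℕ-injective (trans (toℕ-fromℕ< _) (blockIndex-firstVertex j))

theorem2p1 : (n : ℕ) → n ≥ 1 → (d : Fin n → ℕ) → (∀ i → d i ≥ 1) →
    ∃[ p ] ∃[ q ] (p ≥ 1 × q ≥ 1 × Σ (SignedBipartiteGraph p q) λ G →
      Connected G ×
      (∀ (z : ℤ) → InSignedDegreeSet G z ⇔ (∃[ k ] z ≡ + partialSum d k)))
theorem2p1 (suc n) _ d d≥1 =
  total , total , total≥1 , total≥1 , blockGraph , connected hub (blockIndex-firstVertex d≥1 zero) ,
  λ z → mk⇔ degree∈partialSums partialSum∈degrees
  where
  open BlockGraph d

  hub : Fin total
  hub = firstVertex d≥1 zero

  total≥1 : total ≥ 1
  total≥1 = ≤-<-trans z≤n (toℕ<n hub)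

  degree∈partialSums : ∀ {z} → InSignedDegreeSet blockGraph z → ∃[ k ] z ≡ + partialSum d k
  degree∈partialSums (x , refl) = opposite (blockOf (reduce x)) , signedDegree-blockGraph x

  partialSum∈degrees : ∀ {z} → ∃[ k ] z ≡ + partialSum d k → InSignedDegreeSet blockGraph z
  partialSum∈degrees (k , refl) = inj₁ v , (begin
    signedDegree blockGraph (inj₁ v)        ≡⟨ signedDegree-blockGraph (inj₁ v) ⟩
    + partialSum d (opposite (blockOf v))    ≡⟨ cong (+_ ∘ partialSum d ∘ opposite) (blockOf-firstVertex d≥1 (opposite k)) ⟩
    + partialSum d (opposite (opposite k))   ≡⟨ cong (+_ ∘ partialSum d) (opposite-involutive k) ⟩
    + partialSum d k                         ∎)
    where
    open ≡-Reasoning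
    v : Fin total
    v = firstVertex d≥1 (opposite k)
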